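{- Let $k$ be a positive integer and let $s_1,\dots,s_{k-1}$ be fixed integers with $s_i\geq 2$ for all $1\leq i\leq k-1$; let $m=\min\{s_1,\dots,s_{k-1}\}$. Then the following are equivalent: (a) for all integers $n\geq \sum_{i=1}^{k-1}s_i + m$, \[ \chi\left(\mathrm{KG}^{2}(n,k)_{(s_1,\dots,s_{k-1},m)\textup{ -stab}}\right) = n-\sum_{i=1}^{k-1}s_i; \] (b) for all positive integers $s_k$ and all integers $n$ with $s_k\leq 2m$ and $n\geq\sum_{i=1}^{k}s_i$, \[ \chi\left(\mathrm{KG}^{2}(n,k)_{(s_1,\dots,s_{k-1},s_k)\textup{ -stab}}\right) = n-\sum_{i=1}^{k-1}s_i-\max\{0,s_k-m\}. \]
   Context: For a positive integer $n$, $[n]=\{1,\dots,n\}$. For a $k$-subset $A\subseteq[n]$, let $A(1)<\dots<A(k)$ be its elements in increasing order. For a vector $\vec{s}=(s_1,\dots,s_k)$ of positive integers, $A$ is $\vec{s}$-stable if $A(j+1)-A(j)\geq s_j$ for $1\leq j\leq k-1$ and $A(k)-A(1)\leq n-s_k$. The graph $\mathrm{KG}^{2}(n,k)_{\vec{s}\textup{ -stab}}$ has as vertices all $\vec{s}$-stable $k$-subsets of $[n]$, two vertices adjacent iff disjoint. $\chi$ denotes the chromatic number. -}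

module Defs where

open import Data.Nat using (ℕ; zero; suc; _+_; _≤_; _<_; _⊓_)
open import Data.Fin using (Fin; zero; suc; inject₁; fromℕ)
open import Data.Product using (Σ; ∃; _×_)
open import Relation.Binary.PropositionalEquality using (_≡_; _≢_)

sumF : ∀ {j} → (Fin j → ℕ) → ℕ
sumF {zero}  s = 0
sumF {suc j} s = s zero + sumF (λ i → s (suc i))

-- minimum of a finite sequence (value 0 on the empty sequence; only used for j ≥ 1)
minF : ∀ {j} → (Fin j → ℕ) → ℕ
minF {zero}        s = 0
minF {suc zero}    s = s zero
minF {suc (suc j)} s = s zero ⊓ minF (λ i → s (suc i))

snoc : ∀ {j} → (Fin j → ℕ) → ℕ → Fin (suc j) → ℕ
snoc {zero}  s t zero    = t
snoc {suc j} s t zero    = s zero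
snoc {suc j} s t (suc i) = snoc (λ i → s (suc i)) t i

-- A (suc j)-subset of [n], given by its elements A(1)<…<A(k) (k = suc j),
-- indexed by Fin (suc j) (index 0 ↦ A(1), …, fromℕ j ↦ A(k)).
IsKSubset : (n j : ℕ) → (Fin (suc j) → ℕ) → Set
IsKSubset n j A = (∀ i → 1 ≤ A i × A i ≤ n) × (∀ (i : Fin j) → A (inject₁ i) < A (suc i))

-- s-stability: A(i+1) - A(i) ≥ s_i for i < k, and A(k) - A(1) ≤ n - s_k
-- (written additively, which is the integer inequality exactly).
IsStable : (n j : ℕ) → (Fin (suc j) → ℕ) → (Fin (suc j) → ℕ) → Set
IsStable n j s A =
  (∀ (i : Fin j) → A (inject₁ i) + s (inject₁ i) ≤ A (suc i)) ×
  (A (fromℕ j) + s (fromℕ j) ≤ n + A zero)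

StableVertex : (n j : ℕ) → (Fin (suc j) → ℕ) → Set
StableVertex n j s = Σ (Fin (suc j) → ℕ) (λ A → IsKSubset n j A × IsStable n j s A)

Adjacent : (n j : ℕ) (s : Fin (suc j) → ℕ) → StableVertex n j s → StableVertex n j s → Set
Adjacent n j s (A Data.Product., _) (B Data.Product., _) = ∀ a b → A a ≢ B b

Colorable : (n j : ℕ) → (Fin (suc j) → ℕ) → ℕ → Set
Colorable n j s c =
  ∃ λ (f : StableVertex n j s → Fin c) → ∀ u v → Adjacent n j s u v → f u ≢ f v

ChromaticNumberIs : (n j : ℕ) → (Fin (suc j) → ℕ) → ℕ → Set
ChromaticNumberIs n j s c = Colorable n j s c × (∀ d → Colorable n j s d → c ≤ d)

{-# OPTIONS --safe #-}
-- Let m = s_p be a minimal gap, P = s_1 + ⋯ + s_{p-1}, S = Σ s_i and d = t ∸ m ≤ m.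
-- Every (s, t)-stable set meets the window [P + d + 1, P + n − S]: either A(p) does, or
-- A(p) ≤ P + d forces A(1) ≤ d and then A(p+1) does. Colouring each set by such an element
-- is proper, since equally coloured sets intersect; this gives n − S − d colours.
-- Conversely, (s, m)-stable subsets of [n − d] are (s, t)-stable in [n], so (a) gives the
-- lower bound, unless n − d < S + m; then d = 0, and the n − S translates of the prefix-sum
-- set {1, 1 + s_1, 1 + s_1 + s_2, …} form a clique, as distinct prefix sums differ by ≥ m.
module Submission where

open import Defs
open import Data.Nat using (ℕ; zero; suc; _+_; _∸_; _*_; _≤_; _<_; z≤n; s≤s; s≤s⁻¹; _≤?_)
open import Data.Nat.Properties
open import Data.Nat.Tactic.RingSolver using (solve-∀)
open import Algebra.Properties.CommutativeSemigroup +-commutativeSemigroup using (x∙yz≈y∙xz)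
open import Data.Fin using (Fin; zero; suc; inject₁; fromℕ; toℕ; fromℕ<)
open import Data.Fin.Properties using (fromℕ<-injective; toℕ-injective; injective⇒≤; toℕ<n)
import Data.Fin.Properties as Fin
open import Data.Vec.Functional using (tail)
open import Data.Product using (∃; _×_; _,_; proj₁; proj₂)
open import Data.Sum using (_⊎_; inj₁; inj₂)
import Data.Sum as Sum
open import Data.Empty using (⊥-elim)
open import Function.Base using (_∘_)
open import Function.Bundles using (_⇔_; mk⇔)
open import Relation.Binary.PropositionalEquality
open import Relation.Nullary using (Dec; yes; no; ¬_)

open ≤-Reasoning

0<n∸m⇒m+[n∸m]≡n : ∀ m {n} → 0 < n ∸ m → m + (n ∸ m) ≡ n
0<n∸m⇒m+[n∸m]≡n m {n} 0<n∸m = m+[n∸m]≡n {m} {n} (<⇒≤ (m∸n≢0⇒n<m (m<n⇒n≢0 0<n∸m)))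

sumTo : ∀ {j} → (Fin j → ℕ) → Fin (suc j) → ℕ
sumTo s zero = 0
sumTo {suc j} s (suc r) = s zero + sumTo (tail s) r

sumFrom : ∀ {j} → (Fin j → ℕ) → Fin (suc j) → ℕ
sumFrom s zero = sumF s
sumFrom {suc j} s (suc r) = sumFrom (tail s) r

sumTo+sumFrom≡sumF : ∀ {j} (s : Fin j → ℕ) r → sumTo s r + sumFrom s r ≡ sumF s
sumTo+sumFrom≡sumF s zero = refl
sumTo+sumFrom≡sumF {suc j} s (suc r) =
  trans (+-assoc (s zero) _ _) (cong (s zero +_) (sumTo+sumFrom≡sumF (tail s) r))

sumTo-fromℕ : ∀ {j} (s : Fin j → ℕ) → sumTo s (fromℕ j) ≡ sumF s
sumTo-fromℕ {zero} s = refl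
sumTo-fromℕ {suc j} s = cong (s zero +_) (sumTo-fromℕ (tail s))

sumTo-suc : ∀ {j} (s : Fin j → ℕ) i → sumTo s (suc i) ≡ sumTo s (inject₁ i) + s i
sumTo-suc s zero = +-identityʳ (s zero)
sumTo-suc {suc j} s (suc i) =
  trans (cong (s zero +_) (sumTo-suc (tail s) i)) (sym (+-assoc (s zero) _ _))

sumTo-separated : ∀ {j m} (s : Fin j → ℕ) → (∀ i → m ≤ s i) → ∀ a b → a ≢ b →
  sumTo s a + m ≤ sumTo s b ⊎ sumTo s b + m ≤ sumTo s a
sumTo-separated s m≤s zero zero a≢b = ⊥-elim (a≢b refl)
sumTo-separated {suc j} s m≤s zero (suc b) _ = inj₁ (≤-trans (m≤s zero) (m≤m+n _ _))
sumTo-separated {suc j} s m≤s (suc a) zero _ = inj₂ (≤-trans (m≤s zero) (m≤m+n _ _))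
sumTo-separated {suc j} {m} s m≤s (suc a) (suc b) a≢b =
  Sum.map shift shift (sumTo-separated (tail s) (m≤s ∘ suc) a b (a≢b ∘ cong suc))
  where
  shift : ∀ {x y} → x + m ≤ y → s zero + x + m ≤ s zero + y
  shift {x} x+m≤y = ≤-trans (≤-reflexive (+-assoc (s zero) x m)) (+-monoʳ-≤ (s zero) x+m≤y)

minF-≤ : ∀ {j} (s : Fin j → ℕ) i → minF s ≤ s i
minF-≤ {suc zero} s zero = ≤-refl
minF-≤ {suc (suc j)} s zero = m⊓n≤m _ _
minF-≤ {suc (suc j)} s (suc i) = ≤-trans (m⊓n≤n _ _) (minF-≤ (tail s) i)

minF-attained : ∀ {j} (s : Fin (suc j) → ℕ) → ∃ λ p → s p ≡ minF s
minF-attained {zero} s = zero , refl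
minF-attained {suc j} s with ⊓-sel (s zero) (minF (tail s))
... | inj₁ min≡s₀ = zero , sym min≡s₀
... | inj₂ min≡minTail = let p , sp = minF-attained (tail s) in suc p , trans sp (sym min≡minTail)

snoc-inject₁ : ∀ {j} (s : Fin j → ℕ) t i → snoc s t (inject₁ i) ≡ s i
snoc-inject₁ {suc j} s t zero = refl
snoc-inject₁ {suc j} s t (suc i) = snoc-inject₁ (tail s) t i

snoc-fromℕ : ∀ {j} (s : Fin j → ℕ) t → snoc s t (fromℕ j) ≡ t
snoc-fromℕ {zero} s t = refl
snoc-fromℕ {suc j} s t = snoc-fromℕ (tail s) t

Spaced : ∀ {j} → (Fin (suc j) → ℕ) → (Fin j → ℕ) → Set
Spaced {j} A s = ∀ (i : Fin j) → A (inject₁ i) + s i ≤ A (suc i)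

spaced-sumTo : ∀ {j} {A : Fin (suc j) → ℕ} {s : Fin j → ℕ} → Spaced A s →
  ∀ r → A zero + sumTo s r ≤ A r
spaced-sumTo {A = A} sp zero = ≤-reflexive (+-identityʳ (A zero))
spaced-sumTo {suc j} {A} {s} sp (suc r) = begin
  A zero + (s zero + sumTo (tail s) r) ≡⟨ +-assoc (A zero) _ _ ⟨
  A zero + s zero + sumTo (tail s) r   ≤⟨ +-monoˡ-≤ _ (sp zero) ⟩
  A (suc zero) + sumTo (tail s) r      ≤⟨ spaced-sumTo {A = tail A} (sp ∘ suc) r ⟩
  A (suc r)                            ∎

spaced-sumFrom : ∀ {j} {A : Fin (suc j) → ℕ} {s : Fin j → ℕ} → Spaced A s →
  ∀ r → A r + sumFrom s r ≤ A (fromℕ j)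
spaced-sumFrom {zero} {A} sp zero = ≤-reflexive (+-identityʳ (A zero))
spaced-sumFrom {suc j} {A} {s} sp zero = begin
  A zero + (s zero + sumF (tail s)) ≡⟨ +-assoc (A zero) _ _ ⟨
  A zero + s zero + sumF (tail s)   ≤⟨ +-monoˡ-≤ _ (sp zero) ⟩
  A (suc zero) + sumF (tail s)      ≤⟨ spaced-sumFrom {A = tail A} (sp ∘ suc) zero ⟩
  A (fromℕ (suc j))                 ∎
spaced-sumFrom {suc j} {A} sp (suc r) = spaced-sumFrom {A = tail A} (sp ∘ suc) r

stable⇒spaced : ∀ {n j t} {s : Fin j → ℕ} {A : Fin (suc j) → ℕ} →
  IsStable n j (snoc s t) A → Spaced A s
stable⇒spaced {t = t} {s} {A} (gaps , _) i =
  subst (λ x → A (inject₁ i) + x ≤ A (suc i)) (snoc-inject₁ s t i) (gaps i)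

stable⇒span : ∀ {n j t} {s : Fin j → ℕ} {A : Fin (suc j) → ℕ} →
  IsStable n j (snoc s t) A → A (fromℕ j) + t ≤ n + A zero
stable⇒span {n} {j} {t} {s} {A} (_ , span) =
  subst (λ x → A (fromℕ j) + x ≤ n + A zero) (snoc-fromℕ s t) span

stable-weaken : ∀ {n n′ j t t′} {s : Fin j → ℕ} → n′ ≤ n → t + n′ ≤ t′ + n →
  StableVertex n′ j (snoc s t′) → StableVertex n j (snoc s t)
stable-weaken {n} {n′} {j} {t} {t′} {s} n′≤n t+n′≤t′+n (A , (bounds , increasing) , stable) =
  A , ((λ i → proj₁ (bounds i) , ≤-trans (proj₂ (bounds i)) n′≤n) , increasing) ,
  (gaps , subst (λ x → A (fromℕ j) + x ≤ n + A zero) (sym (snoc-fromℕ s t)) span)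
  where
  gaps : ∀ i → A (inject₁ i) + snoc s t (inject₁ i) ≤ A (suc i)
  gaps i = subst (λ x → A (inject₁ i) + x ≤ A (suc i))
             (trans (snoc-inject₁ s t′ i) (sym (snoc-inject₁ s t i))) (proj₁ stable i)
  span : A (fromℕ j) + t ≤ n + A zero
  span = +-cancelʳ-≤ n′ _ _ (begin
    A (fromℕ j) + t + n′   ≡⟨ +-assoc (A (fromℕ j)) t n′ ⟩
    A (fromℕ j) + (t + n′) ≤⟨ +-monoʳ-≤ (A (fromℕ j)) t+n′≤t′+n ⟩
    A (fromℕ j) + (t′ + n) ≡⟨ +-assoc (A (fromℕ j)) t′ n ⟨
    A (fromℕ j) + t′ + n   ≤⟨ +-monoˡ-≤ n (stable⇒span {A = A} stable) ⟩
    n′ + A zero + n        ≡⟨ swap n′ (A zero) n ⟩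
    n + A zero + n′        ∎)
    where
    swap : ∀ a b c → a + b + c ≡ c + b + a
    swap = solve-∀

colorable-weaken : ∀ {n n′ j t t′ c} {s : Fin j → ℕ} → n′ ≤ n → t + n′ ≤ t′ + n →
  Colorable n j (snoc s t) c → Colorable n′ j (snoc s t′) c
colorable-weaken {n} {n′} {j} {t} {t′} {s = s} n′≤n t+n′≤t′+n (f , proper) =
  f ∘ weaken , λ u v → proper (weaken u) (weaken v)
  where
  weaken : StableVertex n′ j (snoc s t′) → StableVertex n j (snoc s t)
  weaken = stable-weaken n′≤n t+n′≤t′+n

InWindow : ∀ {j} → (Fin (suc j) → ℕ) → ℕ → ℕ → Set
InWindow A lo hi = ∃ λ a → lo ≤ A a × A a < hi

colorable-window : ∀ {n j} {s : Fin (suc j) → ℕ} lo hi →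
  (∀ (u : StableVertex n j s) → InWindow (proj₁ u) lo hi) → Colorable n j s (hi ∸ lo)
colorable-window {n} {j} {s} lo hi window = colour , proper
  where
  colour : StableVertex n j s → Fin (hi ∸ lo)
  colour u with window u
  ... | _ , lo≤ , <hi = fromℕ< (∸-monoˡ-< <hi lo≤)
  proper : ∀ u v → Adjacent n j s u v → colour u ≢ colour v
  proper u v disjoint same with window u | window v
  ... | a , lo≤Aa , Aa<hi | b , lo≤Bb , Bb<hi =
    disjoint a b (∸-cancelʳ-≡ lo≤Aa lo≤Bb (fromℕ<-injective _ _ _ _ same))

stable-inWindow : ∀ {n j t} (s : Fin j → ℕ) (p : Fin j) → t ∸ s p ≤ s p →
  (u : StableVertex n j (snoc s t)) →
  InWindow (proj₁ u) (suc (sumTo s (inject₁ p) + (t ∸ s p)))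
                     (suc (sumTo s (inject₁ p) + (n ∸ sumF s)))
stable-inWindow {n} {j} {t} s p d≤sp (A , (bounds , _) , stable) =
  window (suc (P + d) ≤? A (inject₁ p))
  where
  P S d : ℕ
  P = sumTo s (inject₁ p)
  S = sumF s
  d = t ∸ s p
  spaced : Spaced A s
  spaced = stable⇒spaced {A = A} stable
  1≤A₀ : 1 ≤ A zero
  1≤A₀ = proj₁ (bounds zero)
  A₀+P≤Ap : A zero + P ≤ A (inject₁ p)
  A₀+P≤Ap = spaced-sumTo {A = A} spaced (inject₁ p)
  Ak≤n : A (fromℕ j) ≤ n
  Ak≤n = proj₂ (bounds (fromℕ j))
  below : ∀ {a P} → a + S ≤ P + n → a < suc (P + (n ∸ S))
  below {a} {P} a+S≤P+n = s≤s (≤-trans (m+n≤o⇒m≤o∸n a a+S≤P+n) (≤-reflexive (+-∸-assoc P S≤n)))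
    where
    S≤n : S ≤ n
    S≤n = ≤-trans (m≤n+m S (A zero)) (≤-trans (spaced-sumFrom {A = A} spaced zero) Ak≤n)

  window : Dec (suc (P + d) ≤ A (inject₁ p)) → InWindow A (suc (P + d)) (suc (P + (n ∸ S)))
  window (yes lo≤Ap) = inject₁ p , lo≤Ap , below (begin
    A (inject₁ p) + S                           ≡⟨ cong (A (inject₁ p) +_) (sumTo+sumFrom≡sumF s (inject₁ p)) ⟨
    A (inject₁ p) + (P + sumFrom s (inject₁ p)) ≡⟨ x∙yz≈y∙xz (A (inject₁ p)) P _ ⟩
    P + (A (inject₁ p) + sumFrom s (inject₁ p)) ≤⟨ +-monoʳ-≤ P (≤-trans Ap+F≤Ak Ak≤n) ⟩
    P + n                                       ∎)
    where
    Ap+F≤Ak : A (inject₁ p) + sumFrom s (inject₁ p) ≤ A (fromℕ j)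
    Ap+F≤Ak = spaced-sumFrom {A = A} spaced (inject₁ p)
  window (no lo≰Ap) = suc p , lo≤Aq , below Aq+S≤P+n
    where
    A₀≤d : A zero ≤ d
    A₀≤d = +-cancelʳ-≤ P (A zero) d (begin
      A zero + P    ≤⟨ A₀+P≤Ap ⟩
      A (inject₁ p) ≤⟨ s≤s⁻¹ (≰⇒> lo≰Ap) ⟩
      P + d         ≡⟨ +-comm P d ⟩
      d + P         ∎)
    sp+d≡t : s p + d ≡ t
    sp+d≡t = 0<n∸m⇒m+[n∸m]≡n (s p) (≤-trans 1≤A₀ A₀≤d)
    lo≤Aq : suc (P + d) ≤ A (suc p)
    lo≤Aq = begin
      suc P + d              ≤⟨ +-mono-≤ (+-monoˡ-≤ P 1≤A₀) d≤sp ⟩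
      A zero + P + s p       ≤⟨ +-monoˡ-≤ (s p) A₀+P≤Ap ⟩
      A (inject₁ p) + s p    ≤⟨ spaced p ⟩
      A (suc p)              ∎
    Aq F : ℕ
    Aq = A (suc p)
    F = sumFrom s (suc p)
    Aq+F+sp≤n : Aq + F + s p ≤ n
    Aq+F+sp≤n = +-cancelʳ-≤ d _ n (begin
      Aq + F + s p + d   ≡⟨ +-assoc (Aq + F) (s p) d ⟩
      Aq + F + (s p + d) ≡⟨ cong (Aq + F +_) sp+d≡t ⟩
      Aq + F + t         ≤⟨ +-monoˡ-≤ t (spaced-sumFrom {A = A} spaced (suc p)) ⟩
      A (fromℕ j) + t    ≤⟨ stable⇒span {A = A} stable ⟩
      n + A zero         ≤⟨ +-monoʳ-≤ n A₀≤d ⟩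
      n + d              ∎)
    Aq+S≤P+n : Aq + S ≤ P + n
    Aq+S≤P+n = begin
      Aq + S                     ≡⟨ cong (Aq +_) (sumTo+sumFrom≡sumF s (suc p)) ⟨
      Aq + (sumTo s (suc p) + F) ≡⟨ cong (λ x → Aq + (x + F)) (sumTo-suc s p) ⟩
      Aq + (P + s p + F)         ≡⟨ rearrange Aq P (s p) F ⟩
      P + (Aq + F + s p)         ≤⟨ +-monoʳ-≤ P Aq+F+sp≤n ⟩
      P + n                      ∎
      where
      rearrange : ∀ a b c e → a + (b + c + e) ≡ b + (a + e + c)
      rearrange = solve-∀

colorable-snoc : ∀ {n j t} (s : Fin j → ℕ) (p : Fin j) → t ∸ s p ≤ s p →
  Colorable n j (snoc s t) (n ∸ sumF s ∸ (t ∸ s p))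
colorable-snoc {n} {j} {t} s p d≤sp =
  subst (Colorable n j (snoc s t)) ([m+n]∸[m+o]≡n∸o (sumTo s (inject₁ p)) (n ∸ sumF s) (t ∸ s p))
    (colorable-window {s = snoc s t} _ _ (stable-inWindow s p d≤sp))

+-separated⇒≢ : ∀ {m x y P Q} → x < m → P + m ≤ Q → x + P ≢ y + Q
+-separated⇒≢ {m} {x} {y} {P} {Q} x<m P+m≤Q = <⇒≢ (begin-strict
  x + P ≡⟨ +-comm x P ⟩
  P + x <⟨ +-monoʳ-< P x<m ⟩
  P + m ≤⟨ P+m≤Q ⟩
  Q     ≤⟨ m≤n+m Q y ⟩
  y + Q ∎)

translates-disjoint : ∀ {j m x y} (s : Fin j → ℕ) → (∀ i → m ≤ s i) →
  x < m → y < m → x ≢ y → ∀ a b → x + sumTo s a ≢ y + sumTo s b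
translates-disjoint s m≤s x<m y<m x≢y a b with a Fin.≟ b
... | yes refl = x≢y ∘ +-cancelʳ-≡ (sumTo s a) _ _
... | no a≢b with sumTo-separated s m≤s a b a≢b
...   | inj₁ Pa+m≤Pb = +-separated⇒≢ x<m Pa+m≤Pb
...   | inj₂ Pb+m≤Pa = +-separated⇒≢ y<m Pb+m≤Pa ∘ sym

translate : ∀ {n j t} (s : Fin j → ℕ) x → (∀ i → 0 < s i) →
  x + sumF s < n → sumF s + t ≤ n → StableVertex n j (snoc s t)
translate {n} {j} {t} s x 0<s x+S<n S+t≤n = A , (bounds , increasing) , (gaps , span)
  where
  A : Fin (suc j) → ℕ
  A r = suc (x + sumTo s r)
  bounds : ∀ r → 1 ≤ A r × A r ≤ n
  bounds r = s≤s z≤n , ≤-trans (s≤s (+-monoʳ-≤ x sumTo≤S)) x+S<n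
    where
    sumTo≤S : sumTo s r ≤ sumF s
    sumTo≤S = ≤-trans (m≤m+n _ _) (≤-reflexive (sumTo+sumFrom≡sumF s r))
  gap : ∀ i → A (inject₁ i) + s i ≡ A (suc i)
  gap i = cong suc (trans (+-assoc x _ (s i)) (cong (x +_) (sym (sumTo-suc s i))))
  increasing : ∀ i → A (inject₁ i) < A (suc i)
  increasing i = ≤-trans (m<m+n (A (inject₁ i)) (0<s i)) (≤-reflexive (gap i))
  gaps : ∀ i → A (inject₁ i) + snoc s t (inject₁ i) ≤ A (suc i)
  gaps i = ≤-reflexive (trans (cong (A (inject₁ i) +_) (snoc-inject₁ s t i)) (gap i))
  span : A (fromℕ j) + snoc s t (fromℕ j) ≤ n + A zero
  span = begin
    suc (x + sumTo s (fromℕ j)) + snoc s t (fromℕ j) ≡⟨ cong₂ (λ a b → suc (x + a) + b) (sumTo-fromℕ s) (snoc-fromℕ s t) ⟩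
    suc (x + sumF s) + t                               ≡⟨ rearrange x (sumF s) t ⟩
    sumF s + t + suc (x + 0)                           ≤⟨ +-monoˡ-≤ (suc (x + 0)) S+t≤n ⟩
    n + suc (x + 0)                                    ∎
    where
    rearrange : ∀ x S t → suc (x + S) + t ≡ S + t + suc (x + 0)
    rearrange = solve-∀

colorable⇒n∸sumF≤ : ∀ {n j t m c} (s : Fin j → ℕ) → (∀ i → m ≤ s i) →
  sumF s + t ≤ n → n ≤ sumF s + m → Colorable n j (snoc s t) c → n ∸ sumF s ≤ c
colorable⇒n∸sumF≤ {n} {j} {t} {m} s m≤s S+t≤n n≤S+m (f , proper) =
  injective⇒≤ {f = f ∘ clique} injective
  where
  S : ℕ
  S = sumF s
  x<m : (x : Fin (n ∸ S)) → toℕ x < m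
  x<m x = ≤-trans (toℕ<n x) (≤-trans (∸-monoˡ-≤ S n≤S+m) (≤-reflexive (m+n∸m≡n S m)))
  clique : Fin (n ∸ S) → StableVertex n j (snoc s t)
  clique x = translate s (toℕ x) (λ i → <-≤-trans (≤-<-trans z≤n (x<m x)) (m≤s i)) x+S<n S+t≤n
    where
    x+S<n : toℕ x + S < n
    x+S<n = ≤-trans (+-monoˡ-≤ S (toℕ<n x)) (≤-reflexive (m∸n+n≡m (≤-trans (m≤m+n S t) S+t≤n)))
  injective : ∀ {x y} → f (clique x) ≡ f (clique y) → x ≡ y
  injective {x} {y} same with x Fin.≟ y
  ... | yes x≡y = x≡y
  ... | no x≢y = ⊥-elim (proper (clique x) (clique y) disjoint same)
    where
    disjoint : Adjacent n j (snoc s t) (clique x) (clique y)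
    disjoint a b = translates-disjoint s m≤s (x<m x) (x<m y) (x≢y ∘ toℕ-injective) a b ∘ suc-injective

chromatic-at-min⇒chromatic-snoc : ∀ {j} (s : Fin (suc j) → ℕ) →
  (∀ n → sumF s + minF s ≤ n → ChromaticNumberIs n (suc j) (snoc s (minF s)) (n ∸ sumF s)) →
  ∀ t n → t ≤ 2 * minF s → sumF s + t ≤ n →
  ChromaticNumberIs n (suc j) (snoc s t) (n ∸ sumF s ∸ (t ∸ minF s))
chromatic-at-min⇒chromatic-snoc {j} s χ-at-min t n t≤2m S+t≤n = upper , lower
  where
  m S d : ℕ
  m = minF s
  S = sumF s
  d = t ∸ m
  d≤m : d ≤ m
  d≤m = ≤-trans (∸-monoˡ-≤ m t≤2m) (≤-reflexive (trans (m+n∸m≡n m (m + 0)) (+-identityʳ m)))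
  d≤n : d ≤ n
  d≤n = ≤-trans (m∸n≤m t m) (≤-trans (m≤n+m t S) S+t≤n)

  upper : Colorable n (suc j) (snoc s t) (n ∸ S ∸ d)
  upper = let p , sp = minF-attained s in
    subst (λ x → Colorable n (suc j) (snoc s t) (n ∸ S ∸ (t ∸ x))) sp
      (colorable-snoc s p (subst (λ x → t ∸ x ≤ x) (sym sp) d≤m))

  lower : ∀ c → Colorable n (suc j) (snoc s t) c → n ∸ S ∸ d ≤ c
  lower c col with S + m ≤? n ∸ d
  ... | yes S+m≤n∸d = begin
    n ∸ S ∸ d   ≡⟨ ∸-+-assoc n S d ⟩
    n ∸ (S + d) ≡⟨ cong (n ∸_) (+-comm S d) ⟩
    n ∸ (d + S) ≡⟨ ∸-+-assoc n d S ⟨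
    n ∸ d ∸ S   ≤⟨ proj₂ (χ-at-min (n ∸ d) S+m≤n∸d) c (colorable-weaken (m∸n≤m n d) t+[n∸d]≤m+n col) ⟩
    c           ∎
    where
    t+[n∸d]≤m+n : t + (n ∸ d) ≤ m + n
    t+[n∸d]≤m+n = begin
      t + (n ∸ d)       ≤⟨ +-monoˡ-≤ (n ∸ d) (m≤n+m∸n t m) ⟩
      m + d + (n ∸ d)   ≡⟨ +-assoc m d (n ∸ d) ⟩
      m + (d + (n ∸ d)) ≡⟨ cong (m +_) (m+[n∸m]≡n d≤n) ⟩
      m + n             ∎
  ... | no S+m≰n∸d = subst (λ x → n ∸ S ∸ x ≤ c) (sym d≡0)
                       (colorable⇒n∸sumF≤ s (minF-≤ s) S+t≤n n≤S+m col)
    where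
    d≡0 : d ≡ 0
    d≡0 = n<1⇒n≡0 (≰⇒> λ 0<d → S+m≰n∸d (m+n≤o⇒m≤o∸n (S + m) (begin
      S + m + d   ≡⟨ +-assoc S m d ⟩
      S + (m + d) ≡⟨ cong (S +_) (0<n∸m⇒m+[n∸m]≡n m 0<d) ⟩
      S + t       ≤⟨ S+t≤n ⟩
      n           ∎)))
    n≤S+m : n ≤ S + m
    n≤S+m = <⇒≤ (≰⇒> (subst (λ x → ¬ (S + m ≤ n ∸ x)) d≡0 S+m≰n∸d))

lemma4 : (j : ℕ) → 1 ≤ j → (s : Fin j → ℕ) → (∀ i → 2 ≤ s i) →
    ((∀ n → sumF s + minF s ≤ n →
        ChromaticNumberIs n j (snoc s (minF s)) (n ∸ sumF s))
     ⇔
     (∀ t n → 1 ≤ t → t ≤ 2 * minF s → sumF s + t ≤ n →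
        ChromaticNumberIs n j (snoc s t) (n ∸ sumF s ∸ (t ∸ minF s))))
lemma4 (suc j) _ s 2≤s =
  mk⇔ (λ χ-at-min t n _ → chromatic-at-min⇒chromatic-snoc s χ-at-min t n) at-min
  where
  at-min : (∀ t n → 1 ≤ t → t ≤ 2 * minF s → sumF s + t ≤ n →
              ChromaticNumberIs n (suc j) (snoc s t) (n ∸ sumF s ∸ (t ∸ minF s))) →
           ∀ n → sumF s + minF s ≤ n → ChromaticNumberIs n (suc j) (snoc s (minF s)) (n ∸ sumF s)
  at-min χ n S+m≤n = subst (ChromaticNumberIs n (suc j) (snoc s (minF s)) ∘ (n ∸ sumF s ∸_))
    (n∸n≡0 (minF s)) (χ (minF s) n 1≤m (m≤m+n (minF s) _) S+m≤n)
    where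
    1≤m : 1 ≤ minF s
    1≤m = let p , sp = minF-attained s in ≤-trans (s≤s z≤n) (subst (2 ≤_) sp (2≤s p))
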